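{- Let $G$ be a finite simple graph with $p\ge1$ vertices and $q$ edges, write $q=tp+t_0$ with $t$ a nonnegative integer and $0\le t_0\le p-1$, and suppose $G$ is max-$\lambda$. Suppose $0\le t_0<\frac{p}{4}$ or $\frac{p}{2}\le t_0<\frac{3p}{4}$. If $\lambda(\mathcal{D}[G])=2\lambda(G)$, then $\mathcal{D}[G]$ is max-$\lambda$.
   Context: The total graph $T_2$ is $K_2$ with a loop added at each of its two vertices. The double graph is $\mathcal{D}[G]=G\times T_2$ (Kronecker product): it has vertex set $V(G)\times\{0,1\}$ and $(u,i)$ is adjacent to $(v,j)$ iff $uv\in E(G)$. For a graph $H$ with $p(H)\ge1$ vertices and $q(H)$ edges, $H$ is called max-$\lambda$ if $\lambda(H)=\lfloor 2q(H)/p(H)\rfloor$, where $\lambda$ is edge-connectivity. -}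

module Defs where

open import Data.Nat using (ℕ; zero; suc; _+_; _*_; _<ᵇ_; _/_)
open import Data.Bool using (Bool; true; false; _∧_; not; if_then_else_)
open import Data.Fin using (Fin; toℕ; splitAt)
open import Data.List using (List; map; allFin)
open import Data.Nat.ListAction using (sum)
open import Data.Sum using (_⊎_; [_,_])
open import Data.Product using (Σ; _×_; ∃; ∃-syntax)
open import Relation.Binary.PropositionalEquality using (_≡_)
open import Relation.Nullary using (¬_)
open import Function using (id; _∘_)
open import Data.Empty using (⊥)

record Graph (n : ℕ) : Set where
  field
    adj    : Fin n → Fin n → Bool
    sym    : ∀ u v → adj u v ≡ adj v u
    irrefl : ∀ u → adj u u ≡ false
open Graph public

countPairs : ∀ {n} → (Fin n → Fin n → Bool) → ℕ
countPairs {n} r =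
  sum (map (λ u → sum (map (λ v → if (toℕ u <ᵇ toℕ v) ∧ r u v then 1 else 0)
                           (allFin n)))
           (allFin n))

edges : ∀ {n} → Graph n → ℕ
edges G = countPairs (adj G)

data Reach {n : ℕ} (a : Fin n → Fin n → Bool) : Fin n → Fin n → Set where
  here : ∀ {u} → Reach a u u
  step : ∀ {u v w} → a u v ≡ true → Reach a v w → Reach a u w

record EdgeSet {n : ℕ} (G : Graph n) : Set where
  field
    mem    : Fin n → Fin n → Bool
    memSym : ∀ u v → mem u v ≡ mem v u
    memSub : ∀ u v → mem u v ≡ true → adj G u v ≡ true
open EdgeSet public

deleteEdges : ∀ {n} (G : Graph n) → EdgeSet G → Fin n → Fin n → Bool
deleteEdges G F u v = adj G u v ∧ not (mem F u v)

DisconnectedOrTrivial : ∀ {n} → (Fin n → Fin n → Bool) → Set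
DisconnectedOrTrivial {n} a = (n ≡ 1) ⊎ (∃[ u ] ∃[ v ] ¬ Reach a u v)

IsEdgeConnectivity : ∀ {n} → Graph n → ℕ → Set
IsEdgeConnectivity G k =
  (Σ (EdgeSet G) λ F → countPairs (mem F) ≡ k × DisconnectedOrTrivial (deleteEdges G F))
  × (∀ (F : EdgeSet G) → DisconnectedOrTrivial (deleteEdges G F) →
       Data.Nat._≤_ k (countPairs (mem F)))

IsMaxλ : ∀ {n} → Graph n → Set
IsMaxλ {zero}  G = ⊥
IsMaxλ {suc m} G = IsEdgeConnectivity G ((2 * edges G) / suc m)

-- double graph D[G] = G × T₂ on vertex set Fin (n + n) ≅ Fin n ⊎ Fin n
-- ((u,0) ↦ inj₁ u, (u,1) ↦ inj₂ u); (u,i) ~ (v,j) iff u ~ v in G.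
base : ∀ {n} → Fin (n + n) → Fin n
base {n} x = [ id , id ] (splitAt n x)

double : ∀ {n} → Graph n → Graph (n + n)
double G = record
  { adj    = λ x y → adj G (base x) (base y)
  ; sym    = λ x y → sym G (base x) (base y)
  ; irrefl = λ x → irrefl G (base x)
  }

-- Counting ordered adjacent pairs gives q(𝒟[G]) = 4q, so the max-λ bound of
-- 𝒟[G] is ⌊8q/2p⌋ = ⌊4q/p⌋. Halving this floor is exact, ⌊4q/p⌋ = 2⌊2q/p⌋,
-- as soon as 2·(2q mod p) < p; since 2q ≡ 2t₀ (mod p), the two ranges allowed
-- for t₀ are exactly what makes this hold. Hence the bound equals
-- 2⌊2q/p⌋ = 2λ(G) = λ(𝒟[G]).
module Submission where

open import Defs hiding (sym)
open import Data.Nat using (ℕ; zero; suc; _+_; _*_; _∸_; _/_; _%_; _<ᵇ_; _<_; _≤_; NonZero; z≤n; s≤s)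
open import Data.Nat.Properties
open import Data.Nat.DivMod
open import Data.Nat.Divisibility using (n∣m*n)
import Data.Nat.ListAction as List
open import Data.Bool using (Bool; true; false; _∧_; if_then_else_; T)
open import Data.Fin as Fin using (Fin; toℕ; _↑ˡ_; _↑ʳ_)
open import Data.Fin.Properties using (toℕ-injective; splitAt-↑ˡ; splitAt-↑ʳ)
open import Data.List using (map; allFin; tabulate)
open import Data.List.Properties using (map-tabulate)
open import Data.Sum using (_⊎_; inj₁; inj₂; [_,_]′)
open import Data.Product using (_×_; _,_)
open import Data.Vec.Functional using (Vector)
open import Function using (id; _∘_)
open import Relation.Nullary using (contradiction)
open import Relation.Binary.PropositionalEquality
  using (_≡_; refl; sym; trans; cong; cong₂; subst; module ≡-Reasoning)
open import Algebra.Properties.Semiring.Sum +-*-semiring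
  using (sum; sum-syntax; sum-cong-≗; ∑-distrib-+; ∑-comm; *-distribˡ-sum)

sum-map-allFin : ∀ n (f : Vector ℕ n) → List.sum (map f (allFin n)) ≡ sum f
sum-map-allFin zero    f = refl
sum-map-allFin (suc n) f = cong (f Fin.zero +_) (begin
  List.sum (map f (tabulate Fin.suc))      ≡⟨ cong List.sum (map-tabulate Fin.suc f) ⟩
  List.sum (tabulate (f ∘ Fin.suc))        ≡⟨ cong List.sum (sym (map-tabulate id (f ∘ Fin.suc))) ⟩
  List.sum (map (f ∘ Fin.suc) (allFin n))  ≡⟨ sum-map-allFin n (f ∘ Fin.suc) ⟩
  sum (f ∘ Fin.suc)                        ∎)
  where open ≡-Reasoning

∑-splitAt : ∀ m {k} (f : Vector ℕ (m + k)) →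
  sum f ≡ sum (f ∘ (_↑ˡ k)) + sum (f ∘ (m ↑ʳ_))
∑-splitAt zero    f = refl
∑-splitAt (suc m) f = trans (cong (f Fin.zero +_) (∑-splitAt m (f ∘ Fin.suc)))
                            (sym (+-assoc (f Fin.zero) _ _))

base-↑ˡ : ∀ n (i : Fin n) → base (i ↑ˡ n) ≡ i
base-↑ˡ n i = cong [ id , id ]′ (splitAt-↑ˡ n i n)

base-↑ʳ : ∀ n (i : Fin n) → base (n ↑ʳ i) ≡ i
base-↑ʳ n i = cong [ id , id ]′ (splitAt-↑ʳ n n i)

∑-base : ∀ {n} (f : Vector ℕ n) → sum (f ∘ base) ≡ 2 * sum f
∑-base {n} f = begin
  sum (f ∘ base)                                      ≡⟨ ∑-splitAt n (f ∘ base) ⟩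
  sum (f ∘ base ∘ (_↑ˡ n)) + sum (f ∘ base ∘ (n ↑ʳ_)) ≡⟨ cong₂ _+_ (sum-cong-≗ (cong f ∘ base-↑ˡ n))
                                                                   (sum-cong-≗ (cong f ∘ base-↑ʳ n)) ⟩
  sum f + sum f                                       ≡⟨ cong (sum f +_) (sym (+-identityʳ (sum f))) ⟩
  2 * sum f                                           ∎
  where open ≡-Reasoning

indicator : Bool → ℕ
indicator b = if b then 1 else 0

orderedPairs : ∀ {n} → (Fin n → Fin n → Bool) → ℕ
orderedPairs {n} r = ∑[ u < n ] ∑[ v < n ] indicator (r u v)

ascending : ∀ {n} → (Fin n → Fin n → Bool) → Fin n → Fin n → Bool
ascending r u v = (toℕ u <ᵇ toℕ v) ∧ r u v

countPairs≡orderedPairs-ascending : ∀ {n} (r : Fin n → Fin n → Bool) →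
  countPairs r ≡ orderedPairs (ascending r)
countPairs≡orderedPairs-ascending {n} r = trans (sum-map-allFin n _)
  (sum-cong-≗ (λ u → sum-map-allFin n (indicator ∘ ascending r u)))

<ᵇ≡true⇒< : ∀ m n → (m <ᵇ n) ≡ true → m < n
<ᵇ≡true⇒< m n eq = <ᵇ⇒< m n (subst T (sym eq) _)

<ᵇ≡false⇒≥ : ∀ m n → (m <ᵇ n) ≡ false → n ≤ m
<ᵇ≡false⇒≥ m n eq = ≮⇒≥ (λ m<n → subst T eq (<⇒<ᵇ m<n))

indicator-ascending-split : ∀ {n} (r : Fin n → Fin n → Bool) →
  (∀ u v → r u v ≡ r v u) → (∀ u → r u u ≡ false) → ∀ u v →
  indicator (r u v) ≡ indicator (ascending r u v) + indicator (ascending r v u)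
indicator-ascending-split r r-sym r-irrefl u v
  with toℕ u <ᵇ toℕ v in u<v | toℕ v <ᵇ toℕ u in v<u
... | true  | true  = contradiction (<ᵇ≡true⇒< (toℕ v) (toℕ u) v<u)
                                    (<⇒≯ (<ᵇ≡true⇒< (toℕ u) (toℕ v) u<v))
... | true  | false = sym (+-identityʳ _)
... | false | true  = cong indicator (r-sym u v)
... | false | false
  with toℕ-injective {i = u} {j = v} (≤-antisym (<ᵇ≡false⇒≥ _ _ v<u) (<ᵇ≡false⇒≥ _ _ u<v))
...   | refl = cong indicator (r-irrefl u)

handshake : ∀ {n} (r : Fin n → Fin n → Bool) →
  (∀ u v → r u v ≡ r v u) → (∀ u → r u u ≡ false) →
  orderedPairs r ≡ 2 * countPairs r
handshake {n} r r-sym r-irrefl = begin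
  orderedPairs r
    ≡⟨ sum-cong-≗ (λ u → sum-cong-≗ (indicator-ascending-split r r-sym r-irrefl u)) ⟩
  ∑[ u < n ] ∑[ v < n ] (A u v + A v u)
    ≡⟨ sum-cong-≗ (λ u → ∑-distrib-+ (A u) (λ v → A v u)) ⟩
  ∑[ u < n ] (∑[ v < n ] A u v + ∑[ v < n ] A v u)
    ≡⟨ ∑-distrib-+ (λ u → ∑[ v < n ] A u v) (λ u → ∑[ v < n ] A v u) ⟩
  C + ∑[ u < n ] ∑[ v < n ] A v u
    ≡⟨ cong (C +_) (sym (∑-comm A)) ⟩
  C + C
    ≡⟨ cong (C +_) (sym (+-identityʳ C)) ⟩
  2 * C
    ≡⟨ cong (2 *_) (sym (countPairs≡orderedPairs-ascending r)) ⟩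
  2 * countPairs r ∎
  where
  open ≡-Reasoning
  A : Fin n → Fin n → ℕ
  A u v = indicator (ascending r u v)
  C : ℕ
  C = orderedPairs (ascending r)

orderedPairs-base : ∀ {n} (r : Fin n → Fin n → Bool) →
  orderedPairs (λ x y → r (base x) (base y)) ≡ 4 * orderedPairs r
orderedPairs-base {n} r = begin
  ∑[ x < n + n ] ∑[ y < n + n ] indicator (r (base x) (base y))
    ≡⟨ sum-cong-≗ (λ x → ∑-base (indicator ∘ r (base x))) ⟩
  ∑[ x < n + n ] (2 * degree (base x))
    ≡⟨ sym (*-distribˡ-sum 2 (degree ∘ base)) ⟩
  2 * sum (degree ∘ base)
    ≡⟨ cong (2 *_) (∑-base degree) ⟩
  2 * (2 * orderedPairs r)
    ≡⟨ sym (*-assoc 2 2 (orderedPairs r)) ⟩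
  4 * orderedPairs r ∎
  where
  open ≡-Reasoning
  degree : Fin n → ℕ
  degree u = ∑[ v < n ] indicator (r u v)

edges-double : ∀ {n} (G : Graph n) → edges (double G) ≡ 4 * edges G
edges-double G = *-cancelˡ-≡ _ _ 2 (begin
  2 * edges (double G)
    ≡⟨ sym (handshake (adj (double G)) (Graph.sym (double G)) (irrefl (double G))) ⟩
  orderedPairs (adj (double G))
    ≡⟨ orderedPairs-base (adj G) ⟩
  4 * orderedPairs (adj G)
    ≡⟨ cong (4 *_) (handshake (adj G) (Graph.sym G) (irrefl G)) ⟩
  4 * (2 * edges G)
    ≡⟨ trans (sym (*-assoc 4 2 (edges G))) (*-assoc 2 4 (edges G)) ⟩
  2 * (4 * edges G) ∎)
  where open ≡-Reasoning

[2*m]/n≡2*[m/n] : ∀ m n .{{_ : NonZero n}} → 2 * (m % n) < n → 2 * m / n ≡ 2 * (m / n)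
[2*m]/n≡2*[m/n] m n 2[m%n]<n = begin
  2 * m / n                                 ≡⟨ /-congˡ (cong (2 *_) (m≡m%n+[m/n]*n m n)) ⟩
  2 * (m % n + m / n * n) / n               ≡⟨ /-congˡ (*-distribˡ-+ 2 (m % n) (m / n * n)) ⟩
  (2 * (m % n) + 2 * (m / n * n)) / n       ≡⟨ /-congˡ (cong (2 * (m % n) +_) (sym (*-assoc 2 (m / n) n))) ⟩
  (2 * (m % n) + 2 * (m / n) * n) / n       ≡⟨ +-distrib-/-∣ʳ (2 * (m % n)) (n∣m*n (2 * (m / n))) ⟩
  2 * (m % n) / n + 2 * (m / n) * n / n     ≡⟨ cong₂ _+_ (m<n⇒m/n≡0 2[m%n]<n) (m*n/n≡m (2 * (m / n)) n) ⟩
  2 * (m / n)                               ∎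
  where open ≡-Reasoning

[2*m]%n≡[2*r]%n : ∀ m k r n .{{_ : NonZero n}} → m ≡ k * n + r → (2 * m) % n ≡ (2 * r) % n
[2*m]%n≡[2*r]%n m k r n m≡kn+r = begin
  (2 * m) % n                ≡⟨ cong (λ x → (2 * x) % n) m≡kn+r ⟩
  (2 * (k * n + r)) % n      ≡⟨ cong (_% n) (*-distribˡ-+ 2 (k * n) r) ⟩
  (2 * (k * n) + 2 * r) % n  ≡⟨ cong (_% n) (+-comm (2 * (k * n)) (2 * r)) ⟩
  (2 * r + 2 * (k * n)) % n  ≡⟨ cong (λ x → (2 * r + x) % n) (sym (*-assoc 2 k n)) ⟩
  (2 * r + 2 * k * n) % n    ≡⟨ [m+kn]%n≡m%n (2 * r) (2 * k) n ⟩
  (2 * r) % n                ∎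
  where open ≡-Reasoning

2*[2*r%n]<n : ∀ r n .{{_ : NonZero n}} → r < n →
  4 * r < n ⊎ (n ≤ 2 * r × 4 * r < 3 * n) → 2 * ((2 * r) % n) < n
2*[2*r%n]<n r n r<n (inj₁ 4r<n) = begin-strict
  2 * ((2 * r) % n)   ≡⟨ cong (2 *_) (m<n⇒m%n≡m 2r<n) ⟩
  2 * (2 * r)         ≡⟨ sym (*-assoc 2 2 r) ⟩
  4 * r               <⟨ 4r<n ⟩
  n                   ∎
  where
  open ≤-Reasoning
  2r<n : 2 * r < n
  2r<n = ≤-<-trans (*-monoˡ-≤ r {2} {4} (s≤s (s≤s z≤n))) 4r<n
2*[2*r%n]<n r n r<n (inj₂ (n≤2r , 4r<3n)) = begin-strict
  2 * ((2 * r) % n)      ≡⟨ cong (2 *_) (sym (m≤n⇒[n∸m]%m≡n%m n≤2r)) ⟩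
  2 * ((2 * r ∸ n) % n)  ≡⟨ cong (2 *_) (m<n⇒m%n≡m 2r∸n<n) ⟩
  2 * (2 * r ∸ n)        ≡⟨ *-distribˡ-∸ 2 (2 * r) n ⟩
  2 * (2 * r) ∸ 2 * n    ≡⟨ cong (_∸ 2 * n) (sym (*-assoc 2 2 r)) ⟩
  4 * r ∸ 2 * n          <⟨ m<n+o⇒m∸n<o (4 * r) (2 * n) (subst (4 * r <_) (+-comm n (2 * n)) 4r<3n) ⟩
  n                      ∎
  where
  open ≤-Reasoning
  2r<n+n : 2 * r < n + n
  2r<n+n = <-≤-trans (*-monoʳ-< 2 r<n) (≤-reflexive (cong (n +_) (+-identityʳ n)))
  2r∸n<n : 2 * r ∸ n < n
  2r∸n<n = m<n+o⇒m∸n<o (2 * r) n 2r<n+n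

IsEdgeConnectivity-unique : ∀ {n} {G : Graph n} {k l} →
  IsEdgeConnectivity G k → IsEdgeConnectivity G l → k ≡ l
IsEdgeConnectivity-unique ((F , |F|≡k , F-cuts) , k-min) ((F′ , |F′|≡l , F′-cuts) , l-min) =
  ≤-antisym (subst (_ ≤_) |F′|≡l (k-min F′ F′-cuts)) (subst (_ ≤_) |F|≡k (l-min F F-cuts))

proposition3p5 : (m : ℕ) (G : Graph (suc m)) (t t₀ : ℕ) →
    edges G ≡ t * suc m + t₀ → t₀ < suc m →
    IsMaxλ G →
    (4 * t₀ < suc m ⊎ (suc m ≤ 2 * t₀ × 4 * t₀ < 3 * suc m)) →
    (l : ℕ) → IsEdgeConnectivity G l →
    IsEdgeConnectivity (double G) (2 * l) →
    IsMaxλ (double G)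
proposition3p5 m G t t₀ q≡tp+t₀ t₀<p G-maxλ t₀-range l λG≡l λDG≡2l =
  subst (IsEdgeConnectivity (double G)) (sym ⌊2qDG/pDG⌋≡2l) λDG≡2l
  where
  open ≡-Reasoning
  p : ℕ
  p = suc m
  q : ℕ
  q = edges G
  halving-exact : 2 * ((2 * q) % p) < p
  halving-exact = subst (λ x → 2 * x < p) (sym ([2*m]%n≡[2*r]%n q t t₀ p q≡tp+t₀))
                        (2*[2*r%n]<n t₀ p t₀<p t₀-range)
  ⌊2qDG/pDG⌋≡2l : 2 * edges (double G) / (p + p) ≡ 2 * l
  ⌊2qDG/pDG⌋≡2l = begin
    2 * edges (double G) / (p + p)
      ≡⟨ /-congʳ {m = 2 * edges (double G)} (cong (p +_) (sym (+-identityʳ p))) ⟩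
    2 * edges (double G) / (2 * p)
      ≡⟨ /-congˡ (cong (2 *_) (edges-double G)) ⟩
    2 * (4 * q) / (2 * p)
      ≡⟨ m*n/m*o≡n/o 2 (4 * q) p ⟩
    4 * q / p
      ≡⟨ /-congˡ (*-assoc 2 2 q) ⟩
    2 * (2 * q) / p
      ≡⟨ [2*m]/n≡2*[m/n] (2 * q) p halving-exact ⟩
    2 * (2 * q / p)
      ≡⟨ cong (2 *_) (IsEdgeConnectivity-unique {G = G} G-maxλ λG≡l) ⟩
    2 * l ∎
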